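{- For every finite multiset $\Gamma$ of IMLL formulas and every IMLL formula $\phi$: if $\Gamma\Vdash\phi$ then $\Gamma\vdash\phi$.
   Context: Fix a countably infinite set $\mathbb{A}$ of atoms. IMLL formulas: $\phi::=p\in\mathbb A\mid\phi\otimes\phi\mid\mathrm I\mid\phi\multimap\phi$. $\Gamma,\Delta$ denote finite multisets of formulas, $P,S,T,U,V$ finite multisets of atoms, "$\Gamma,\Delta$" multiset union, $\varnothing$ the empty multiset. $\Gamma\vdash\phi$ means the sequent $\Gamma\triangleright\phi$ is derivable in the system with rules: $\phi\triangleright\phi$; from $\Gamma,\phi\triangleright\psi$ infer $\Gamma\triangleright\phi\multimap\psi$; from $\Gamma\triangleright\phi\multimap\psi$ and $\Delta\triangleright\phi$ infer $\Gamma,\Delta\triangleright\psi$; $\varnothing\triangleright\mathrm I$; from $\Gamma\triangleright\phi$ and $\Delta\triangleright\mathrm I$ infer $\Gamma,\Delta\triangleright\phi$; from $\Gamma\triangleright\phi$ and $\Delta\triangleright\psi$ infer $\Gamma,\Delta\triangleright\phi\otimes\psi$; from $\Gamma\triangleright\phi\otimes\psi$ and $\Delta,\phi,\psi\triangleright\chi$ infer $\Gamma,\Delta\triangleright\chi$. An atomic rule is $(P_1\triangleright p_1,\dots,P_n\triangleright p_n)\Rightarrow p$ ($n\ge0$, $P_i$ finite multisets of atoms, $p_i,p$ atoms). A base is a (possibly infinite) set of atomic rules; $\mathscr C\supseteq\mathscr B$ means extension. Derivability $P\vdash_{\mathscr B}q$ is the least relation with: $[p]\vdash_{\mathscr B}p$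 for every atom $p$; if $(P_1\triangleright p_1,\dots,P_n\triangleright p_n)\Rightarrow p\in\mathscr B$ and $S_i,P_i\vdash_{\mathscr B}p_i$ for $i=1,\dots,n$, then $S_1,\dots,S_n\vdash_{\mathscr B}p$. Support is defined inductively: $\Vdash^P_{\mathscr B}p$ iff $P\vdash_{\mathscr B}p$; $\Vdash^P_{\mathscr B}\phi\otimes\psi$ iff for every $\mathscr X\supseteq\mathscr B$, every $U$ and every atom $p$, if $\phi,\psi\Vdash^U_{\mathscr X}p$ then $\Vdash^{P,U}_{\mathscr X}p$; $\Vdash^P_{\mathscr B}\mathrm I$ iff for every $\mathscr X\supseteq\mathscr B$, $U$, atom $p$, if $\Vdash^U_{\mathscr X}p$ then $\Vdash^{P,U}_{\mathscr X}p$; $\Vdash^P_{\mathscr B}\phi\multimap\psi$ iff $\phi\Vdash^P_{\mathscr B}\psi$; for nonempty $\Gamma,\Delta$: $\Vdash^P_{\mathscr B}\Gamma,\Delta$ iff there are $U,V$ with $P=U,V$, $\Vdash^U_{\mathscr B}\Gamma$ and $\Vdash^V_{\mathscr B}\Delta$ (for a singleton $[\phi]$ this is $\Vdash^P_{\mathscr B}\phi$); for nonempty $\Gamma$: $\Gamma\Vdash^P_{\mathscr B}\phi$ iff for every $\mathscr X\supseteq\mathscr B$ and every $U$, if $\Vdash^U_{\mathscr X}\Gamma$ then $\Vdash^{P,U}_{\mathscr X}\phi$; for empty $\Gamma$, $\Gamma\Vdash^P_{\mathscr B}\phi$ means $\Vdash^P_{\mathscr B}\phi$. Validity: $\Gamma\Vdash\phi$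 iff $\Gamma\Vdash^{\varnothing}_{\mathscr B}\phi$ for every base $\mathscr B$. -}

module Defs where

open import Data.Nat using (ℕ)
open import Data.List using (List; []; _∷_; _++_; [_])
open import Data.List.Relation.Binary.Permutation.Propositional using (_↭_)
open import Data.Product using (Σ; ∃; _×_; _,_)
open import Data.Unit using (⊤)
open import Level using (Lift)
open import Relation.Binary.PropositionalEquality using (_≡_)

Atom : Set
Atom = ℕ

-- Finite multisets are represented by lists, identified up to permutation (_↭_).

infixr 25 _⊗_
infixr 20 _⊸_
data Formula : Set where
  atom : Atom → Formula
  _⊗_  : Formula → Formula → Formula
  𝕀    : Formula
  _⊸_  : Formula → Formula → Formula

-- Natural deduction for IMLL.  Contexts are multisets: the rule `exch`
-- closes derivability under permutation of the context.
infix 4 _⊢_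
data _⊢_ : List Formula → Formula → Set where
  ax   : ∀ {φ} → [ φ ] ⊢ φ
  ⊸I   : ∀ {Γ φ ψ} → (Γ ++ [ φ ]) ⊢ ψ → Γ ⊢ φ ⊸ ψ
  ⊸E   : ∀ {Γ Δ φ ψ} → Γ ⊢ φ ⊸ ψ → Δ ⊢ φ → (Γ ++ Δ) ⊢ ψ
  𝕀I   : [] ⊢ 𝕀
  𝕀E   : ∀ {Γ Δ φ} → Γ ⊢ φ → Δ ⊢ 𝕀 → (Γ ++ Δ) ⊢ φ
  ⊗I   : ∀ {Γ Δ φ ψ} → Γ ⊢ φ → Δ ⊢ ψ → (Γ ++ Δ) ⊢ φ ⊗ ψ
  ⊗E   : ∀ {Γ Δ φ ψ χ} → Γ ⊢ φ ⊗ ψ → (Δ ++ φ ∷ ψ ∷ []) ⊢ χ → (Γ ++ Δ) ⊢ χ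
  exch : ∀ {Γ Δ φ} → Γ ↭ Δ → Γ ⊢ φ → Δ ⊢ φ

-- Atomic rules (P₁ ▷ p₁, …, Pₙ ▷ pₙ) ⇒ p
record AtomicRule : Set where
  constructor _⇒_
  field
    premises   : List (List Atom × Atom)
    conclusion : Atom

Base : Set₁
Base = AtomicRule → Set

_⊇_ : Base → Base → Set
C ⊇ B = ∀ r → B r → C r

mutual
  data Der (B : Base) : List Atom → Atom → Set where
    ref  : ∀ {p} → Der B [ p ] p
    app  : ∀ {ps p S} → B (ps ⇒ p) → DerPrems B ps S → Der B S p
    perm : ∀ {P Q p} → P ↭ Q → Der B P p → Der B Q p

  -- DerPrems B [(P₁,p₁),…,(Pₙ,pₙ)] (S₁,…,Sₙ) : Sᵢ,Pᵢ ⊢_ℬ pᵢ for all i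
  data DerPrems (B : Base) : List (List Atom × Atom) → List Atom → Set where
    []  : DerPrems B [] []
    _∷_ : ∀ {S P q ps T} → Der B (S ++ P) q → DerPrems B ps T
        → DerPrems B ((P , q) ∷ ps) (S ++ T)

Supp : Base → List Atom → Formula → Set₁
Supp B P (atom p) = Lift _ (Der B P p)
Supp B P (φ ⊗ ψ) =
  ∀ X → X ⊇ B → ∀ U p →
    -- φ,ψ ⊩^U_X p  (sequent support with context [φ , ψ], unfolded)
    (∀ Y → Y ⊇ X → ∀ W →
       (Σ (List Atom) λ W₁ → Σ (List Atom) λ W₂ →
          (W ↭ W₁ ++ W₂) × Supp Y W₁ φ × Supp Y W₂ ψ) →
       Der Y (U ++ W) p) →
    Der X (P ++ U) p
Supp B P 𝕀 = ∀ X → X ⊇ B → ∀ U p → Der X U p → Der X (P ++ U) p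
Supp B P (φ ⊸ ψ) =
  -- φ ⊩^P_ℬ ψ, unfolded (context [φ] is nonempty)
  ∀ X → X ⊇ B → ∀ U → Supp X U φ → Supp X (P ++ U) ψ

SuppCtx : Base → List Atom → List Formula → Set₁
SuppCtx B P [] = Lift _ (P ≡ [])   -- not used: only nonempty Γ occur
SuppCtx B P (φ ∷ []) = Supp B P φ
SuppCtx B P (φ ∷ ψ ∷ Γ) =
  Σ (List Atom) λ U → Σ (List Atom) λ V →
    (P ↭ U ++ V) × Supp B U φ × SuppCtx B V (ψ ∷ Γ)

SeqSupp : Base → List Atom → List Formula → Formula → Set₁
SeqSupp B P [] φ = Supp B P φ
SeqSupp B P Γ@(_ ∷ _) φ = ∀ X → X ⊇ B → ∀ U → SuppCtx X U Γ → Supp X (P ++ U) φ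

Valid : List Formula → Formula → Set₁
Valid Γ φ = ∀ B → SeqSupp B [] Γ φ

module Submission where

open import Defs
open import Data.List using (List; []; _∷_; _++_; [_]; map)
open import Data.List.Properties using (map-++; ++-identityʳ)
open import Data.List.Relation.Binary.Permutation.Propositional using (↭-refl; ↭-sym; ↭-reflexive)
import Data.List.Relation.Binary.Permutation.Propositional.Properties as ↭
open import Data.List.Relation.Unary.All as All using (All; []; _∷_)
open import Data.List.Membership.Propositional using (_∈_)
open import Data.List.Membership.Propositional.Properties using (∈-++⁺ˡ; ∈-++⁺ʳ)
open import Data.List.Relation.Unary.Any using (here; there)
open import Data.Nat using (ℕ; zero; suc; _+_; _∸_; _≤_; _<_; s≤s)
open import Data.Nat.Properties using (m≤m+n; m≤n+m; ≤-trans; ≤-refl; m+n≮m; m+n∸m≡n; _<?_)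
import Data.Nat.Properties as ℕ
open import Data.Product using (_,_)
open import Function using (_∘_)
open import Level using (lift; lower)
open import Relation.Binary.Definitions using (DecidableEquality)
open import Relation.Nullary using (yes; no)
open import Relation.Nullary.Decidable using (map′; _×-dec_)
open import Relation.Nullary.Negation using (contradiction)
open import Relation.Binary.PropositionalEquality using (_≡_; refl; sym; trans; cong; cong₂; subst)

-- Every subformula of ⨂ Γ ⊸ φ gets its own atom (atoms naming themselves), and the base 𝒩
-- consists of the atomic images of the natural deduction rules.  In every extension of 𝒩,
-- support of a subformula coincides with derivability of its atom; hence the atoms of Γ
-- support Γ, validity yields a derivation of the atom of φ from them in 𝒩, and decoding
-- that derivation rule by rule is a natural deduction proof of Γ ⊢ φ.

⊢-cast : ∀ {Γ Γ′ φ φ′} → Γ ≡ Γ′ → φ ≡ φ′ → Γ ⊢ φ → Γ′ ⊢ φ′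
⊢-cast refl refl d = d

⊇-refl : ∀ {B} → B ⊇ B
⊇-refl _ r = r

⊇-trans : ∀ {A B C} → C ⊇ B → B ⊇ A → C ⊇ A
⊇-trans C⊇B B⊇A r = C⊇B r ∘ B⊇A r

mutual
  Der-mono : ∀ {B C P p} → C ⊇ B → Der B P p → Der C P p
  Der-mono C⊇B ref        = ref
  Der-mono C⊇B (app r ds) = app (C⊇B _ r) (DerPrems-mono C⊇B ds)
  Der-mono C⊇B (perm π d) = perm π (Der-mono C⊇B d)

  DerPrems-mono : ∀ {B C ps S} → C ⊇ B → DerPrems B ps S → DerPrems C ps S
  DerPrems-mono C⊇B []       = []
  DerPrems-mono C⊇B (d ∷ ds) = Der-mono C⊇B d ∷ DerPrems-mono C⊇B ds

Der-++-identityʳ : ∀ {B S q} → Der B S q → Der B (S ++ []) q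
Der-++-identityʳ {S = S} = perm (↭-sym (↭.++-identityʳ S))

app₀ : ∀ {B p} → B ([] ⇒ p) → Der B [] p
app₀ r = app r []

app₁ : ∀ {B P₁ q₁ p S₁} → B ([ (P₁ , q₁) ] ⇒ p) → Der B (S₁ ++ P₁) q₁ → Der B S₁ p
app₁ {S₁ = S₁} r d = perm (↭.++-identityʳ S₁) (app r (d ∷ []))

app₂ : ∀ {B P₁ q₁ P₂ q₂ p S₁ S₂} → B (((P₁ , q₁) ∷ (P₂ , q₂) ∷ []) ⇒ p) →
       Der B (S₁ ++ P₁) q₁ → Der B (S₂ ++ P₂) q₂ → Der B (S₁ ++ S₂) p
app₂ {S₁ = S₁} {S₂} r d₁ d₂ =
  perm (↭-reflexive (cong (S₁ ++_) (++-identityʳ S₂))) (app r (d₁ ∷ d₂ ∷ []))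

record AtomicEncoding : Set₁ where
  field
    Sub     : Formula → Set
    Sub-⊗ˡ  : ∀ {φ ψ} → Sub (φ ⊗ ψ) → Sub φ
    Sub-⊗ʳ  : ∀ {φ ψ} → Sub (φ ⊗ ψ) → Sub ψ
    Sub-⊸ˡ  : ∀ {φ ψ} → Sub (φ ⊸ ψ) → Sub φ
    Sub-⊸ʳ  : ∀ {φ ψ} → Sub (φ ⊸ ψ) → Sub ψ
    encode  : Formula → Atom
    decode  : Atom → Formula
    encode-atom   : ∀ p → encode (atom p) ≡ p
    decode-encode : ∀ {φ} → Sub φ → decode (encode φ) ≡ φ

module Simulation (E : AtomicEncoding) where
  open AtomicEncoding E

  data 𝒩 : AtomicRule → Set where
    ⊸I-rule : ∀ φ ψ → Sub (φ ⊸ ψ) → 𝒩 ([ ([ encode φ ] , encode ψ) ] ⇒ encode (φ ⊸ ψ))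
    ⊸E-rule : ∀ φ ψ → Sub (φ ⊸ ψ) → 𝒩 ((([] , encode (φ ⊸ ψ)) ∷ ([] , encode φ) ∷ []) ⇒ encode ψ)
    ⊗I-rule : ∀ φ ψ → Sub (φ ⊗ ψ) → 𝒩 ((([] , encode φ) ∷ ([] , encode ψ) ∷ []) ⇒ encode (φ ⊗ ψ))
    ⊗E-rule : ∀ φ ψ p → Sub (φ ⊗ ψ) →
              𝒩 ((([] , encode (φ ⊗ ψ)) ∷ ((encode φ ∷ encode ψ ∷ []) , p) ∷ []) ⇒ p)
    𝕀I-rule : Sub 𝕀 → 𝒩 ([] ⇒ encode 𝕀)
    𝕀E-rule : ∀ p → Sub 𝕀 → 𝒩 ((([] , encode 𝕀) ∷ ([] , p) ∷ []) ⇒ p)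

  -- The elimination clauses of support are instantiated at the atom of the formula itself,
  -- which the introduction rules of 𝒩 derive; conversely the elimination rules of 𝒩 meet
  -- the support clauses by using the atoms of the immediate subformulas as hypotheses.
  mutual
    supp⇒der : ∀ {X P} ψ → Sub ψ → X ⊇ 𝒩 → Supp X P ψ → Der X P (encode ψ)
    supp⇒der (atom p) s X⊇𝒩 h = subst (Der _ _) (sym (encode-atom p)) (lower h)
    supp⇒der {X} {P} (φ ⊗ ψ) s X⊇𝒩 h =
      perm (↭.++-identityʳ P)
        (h X ⊇-refl [] (encode (φ ⊗ ψ)) λ { Y Y⊇X W (W₁ , W₂ , π , h₁ , h₂) →
          let Y⊇𝒩 = ⊇-trans Y⊇X X⊇𝒩 in
          perm (↭-sym π)
            (app₂ (Y⊇𝒩 _ (⊗I-rule φ ψ s))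
              (Der-++-identityʳ (supp⇒der φ (Sub-⊗ˡ s) Y⊇𝒩 h₁))
              (Der-++-identityʳ (supp⇒der ψ (Sub-⊗ʳ s) Y⊇𝒩 h₂))) })
    supp⇒der {X} {P} 𝕀 s X⊇𝒩 h =
      perm (↭.++-identityʳ P) (h X ⊇-refl [] (encode 𝕀) (app₀ (X⊇𝒩 _ (𝕀I-rule s))))
    supp⇒der {X} (φ ⊸ ψ) s X⊇𝒩 h =
      app₁ (X⊇𝒩 _ (⊸I-rule φ ψ s))
        (supp⇒der ψ (Sub-⊸ʳ s) X⊇𝒩
          (h X ⊇-refl [ encode φ ] (der⇒supp φ (Sub-⊸ˡ s) X⊇𝒩 ref)))

    der⇒supp : ∀ {X P} ψ → Sub ψ → X ⊇ 𝒩 → Der X P (encode ψ) → Supp X P ψ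
    der⇒supp (atom p) s X⊇𝒩 d = lift (subst (Der _ _) (encode-atom p) d)
    der⇒supp (φ ⊗ ψ) s X⊇𝒩 d Y Y⊇X U p h =
      app₂ (Y⊇𝒩 _ (⊗E-rule φ ψ p s))
        (Der-++-identityʳ (Der-mono Y⊇X d))
        (h Y ⊇-refl (encode φ ∷ encode ψ ∷ [])
          ( [ encode φ ] , [ encode ψ ] , ↭-refl
          , der⇒supp φ (Sub-⊗ˡ s) Y⊇𝒩 ref
          , der⇒supp ψ (Sub-⊗ʳ s) Y⊇𝒩 ref))
      where Y⊇𝒩 = ⊇-trans Y⊇X X⊇𝒩
    der⇒supp 𝕀 s X⊇𝒩 d Y Y⊇X U p e =
      app₂ (⊇-trans Y⊇X X⊇𝒩 _ (𝕀E-rule p s))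
        (Der-++-identityʳ (Der-mono Y⊇X d)) (Der-++-identityʳ e)
    der⇒supp (φ ⊸ ψ) s X⊇𝒩 d Y Y⊇X U h =
      der⇒supp ψ (Sub-⊸ʳ s) Y⊇𝒩
        (app₂ (Y⊇𝒩 _ (⊸E-rule φ ψ s))
          (Der-++-identityʳ (Der-mono Y⊇X d))
          (Der-++-identityʳ (supp⇒der φ (Sub-⊸ˡ s) Y⊇𝒩 h)))
      where Y⊇𝒩 = ⊇-trans Y⊇X X⊇𝒩

  decode-encode-all : ∀ {Γ} → All Sub Γ → map decode (map encode Γ) ≡ Γ
  decode-encode-all []       = refl
  decode-encode-all (s ∷ ss) = cong₂ _∷_ (decode-encode s) (decode-encode-all ss)

  decode-++-encode : ∀ S {Γ} → All Sub Γ → map decode (S ++ map encode Γ) ≡ map decode S ++ Γ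
  decode-++-encode S {Γ} ss =
    trans (map-++ decode S (map encode Γ)) (cong (map decode S ++_) (decode-encode-all ss))

  decode-++-[] : ∀ S → map decode (S ++ []) ≡ map decode S
  decode-++-[] S = cong (map decode) (++-identityʳ S)

  decode-++-++-[] : ∀ S₁ S₂ → map decode S₁ ++ map decode S₂ ≡ map decode (S₁ ++ (S₂ ++ []))
  decode-++-++-[] S₁ S₂ =
    trans (sym (map-++ decode S₁ S₂)) (cong (map decode ∘ (S₁ ++_)) (sym (++-identityʳ S₂)))

  decode-sound : ∀ {P q} → Der 𝒩 P q → map decode P ⊢ decode q
  decode-sound ref        = ax
  decode-sound (perm π d) = exch (↭.map⁺ decode π) (decode-sound d)
  decode-sound (app (⊸I-rule φ ψ s) (_∷_ {S₁} d [])) =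
    ⊢-cast (sym (decode-++-[] S₁)) (sym (decode-encode s))
      (⊸I (⊢-cast (decode-++-encode S₁ (Sub-⊸ˡ s ∷ [])) (decode-encode (Sub-⊸ʳ s))
            (decode-sound d)))
  decode-sound (app (⊸E-rule φ ψ s) (_∷_ {S₁} d₁ (_∷_ {S₂} d₂ []))) =
    ⊢-cast (decode-++-++-[] S₁ S₂) (sym (decode-encode (Sub-⊸ʳ s)))
      (⊸E (⊢-cast (decode-++-[] S₁) (decode-encode s) (decode-sound d₁))
          (⊢-cast (decode-++-[] S₂) (decode-encode (Sub-⊸ˡ s)) (decode-sound d₂)))
  decode-sound (app (⊗I-rule φ ψ s) (_∷_ {S₁} d₁ (_∷_ {S₂} d₂ []))) =
    ⊢-cast (decode-++-++-[] S₁ S₂) (sym (decode-encode s))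
      (⊗I (⊢-cast (decode-++-[] S₁) (decode-encode (Sub-⊗ˡ s)) (decode-sound d₁))
          (⊢-cast (decode-++-[] S₂) (decode-encode (Sub-⊗ʳ s)) (decode-sound d₂)))
  decode-sound (app (⊗E-rule φ ψ p s) (_∷_ {S₁} d₁ (_∷_ {S₂} d₂ []))) =
    ⊢-cast (decode-++-++-[] S₁ S₂) refl
      (⊗E (⊢-cast (decode-++-[] S₁) (decode-encode s) (decode-sound d₁))
          (⊢-cast (decode-++-encode S₂ (Sub-⊗ˡ s ∷ Sub-⊗ʳ s ∷ [])) refl (decode-sound d₂)))
  decode-sound (app (𝕀I-rule s) []) = ⊢-cast refl (sym (decode-encode s)) 𝕀I
  decode-sound (app (𝕀E-rule p s) (_∷_ {S₁} d₁ (_∷_ {S₂} d₂ []))) =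
    ⊢-cast (decode-++-++-[] S₁ S₂) refl
      (exch (↭.++-comm (map decode S₂) (map decode S₁))
        (𝕀E (⊢-cast (decode-++-[] S₂) refl (decode-sound d₂))
            (⊢-cast (decode-++-[] S₁) (decode-encode s) (decode-sound d₁))))

  supp-encode-ctx : ∀ γ Γ → All Sub (γ ∷ Γ) → SuppCtx 𝒩 (map encode (γ ∷ Γ)) (γ ∷ Γ)
  supp-encode-ctx γ []      (s ∷ []) = der⇒supp γ s ⊇-refl ref
  supp-encode-ctx γ (δ ∷ Γ) (s ∷ ss) =
    [ encode γ ] , map encode (δ ∷ Γ) , ↭-refl , der⇒supp γ s ⊇-refl ref ,
    supp-encode-ctx δ Γ ss

  valid⇒supp-encode : ∀ Γ φ → All Sub Γ → Valid Γ φ → Supp 𝒩 (map encode Γ) φ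
  valid⇒supp-encode []      φ []       v = v 𝒩
  valid⇒supp-encode (γ ∷ Γ) φ ss       v =
    v 𝒩 𝒩 ⊇-refl (map encode (γ ∷ Γ)) (supp-encode-ctx γ Γ ss)

  valid⇒⊢ : ∀ Γ φ → All Sub Γ → Sub φ → Valid Γ φ → Γ ⊢ φ
  valid⇒⊢ Γ φ ss s v =
    ⊢-cast (decode-encode-all ss) (decode-encode s)
      (decode-sound (supp⇒der φ s ⊇-refl (valid⇒supp-encode Γ φ ss v)))

infix 4 _≼_
data _≼_ : Formula → Formula → Set where
  ≼-refl : ∀ {φ} → φ ≼ φ
  ≼-⊗ˡ   : ∀ {χ φ ψ} → χ ≼ φ → χ ≼ φ ⊗ ψ
  ≼-⊗ʳ   : ∀ {χ φ ψ} → χ ≼ ψ → χ ≼ φ ⊗ ψ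
  ≼-⊸ˡ   : ∀ {χ φ ψ} → χ ≼ φ → χ ≼ φ ⊸ ψ
  ≼-⊸ʳ   : ∀ {χ φ ψ} → χ ≼ ψ → χ ≼ φ ⊸ ψ

≼-trans : ∀ {φ ψ χ} → φ ≼ ψ → ψ ≼ χ → φ ≼ χ
≼-trans p ≼-refl   = p
≼-trans p (≼-⊗ˡ q) = ≼-⊗ˡ (≼-trans p q)
≼-trans p (≼-⊗ʳ q) = ≼-⊗ʳ (≼-trans p q)
≼-trans p (≼-⊸ˡ q) = ≼-⊸ˡ (≼-trans p q)
≼-trans p (≼-⊸ʳ q) = ≼-⊸ʳ (≼-trans p q)

subformulas : Formula → List Formula
subformulas (atom p) = [ atom p ]
subformulas (φ ⊗ ψ)  = φ ⊗ ψ ∷ subformulas φ ++ subformulas ψ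
subformulas 𝕀        = [ 𝕀 ]
subformulas (φ ⊸ ψ)  = φ ⊸ ψ ∷ subformulas φ ++ subformulas ψ

≼⇒∈subformulas : ∀ {χ ρ} → χ ≼ ρ → χ ∈ subformulas ρ
≼⇒∈subformulas {ρ = atom p} ≼-refl = here refl
≼⇒∈subformulas {ρ = φ ⊗ ψ}  ≼-refl = here refl
≼⇒∈subformulas {ρ = 𝕀}      ≼-refl = here refl
≼⇒∈subformulas {ρ = φ ⊸ ψ}  ≼-refl = here refl
≼⇒∈subformulas (≼-⊗ˡ q)         = there (∈-++⁺ˡ (≼⇒∈subformulas q))
≼⇒∈subformulas (≼-⊗ʳ {φ = φ} q) = there (∈-++⁺ʳ (subformulas φ) (≼⇒∈subformulas q))
≼⇒∈subformulas (≼-⊸ˡ q)         = there (∈-++⁺ˡ (≼⇒∈subformulas q))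
≼⇒∈subformulas (≼-⊸ʳ {φ = φ} q) = there (∈-++⁺ʳ (subformulas φ) (≼⇒∈subformulas q))

atomSum : Formula → ℕ
atomSum (atom p) = p
atomSum (φ ⊗ ψ)  = atomSum φ + atomSum ψ
atomSum 𝕀        = 0
atomSum (φ ⊸ ψ)  = atomSum φ + atomSum ψ

≼⇒atomSum≤ : ∀ {χ ρ} → χ ≼ ρ → atomSum χ ≤ atomSum ρ
≼⇒atomSum≤ ≼-refl = ≤-refl
≼⇒atomSum≤ (≼-⊗ˡ {φ = φ} {ψ} q) = ≤-trans (≼⇒atomSum≤ q) (m≤m+n (atomSum φ) (atomSum ψ))
≼⇒atomSum≤ (≼-⊗ʳ {φ = φ} {ψ} q) = ≤-trans (≼⇒atomSum≤ q) (m≤n+m (atomSum ψ) (atomSum φ))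
≼⇒atomSum≤ (≼-⊸ˡ {φ = φ} {ψ} q) = ≤-trans (≼⇒atomSum≤ q) (m≤m+n (atomSum φ) (atomSum ψ))
≼⇒atomSum≤ (≼-⊸ʳ {φ = φ} {ψ} q) = ≤-trans (≼⇒atomSum≤ q) (m≤n+m (atomSum ψ) (atomSum φ))

⨂ : List Formula → Formula
⨂ []      = 𝕀
⨂ (φ ∷ Γ) = φ ⊗ ⨂ Γ

∈⇒≼⨂ : ∀ {φ Γ} → φ ∈ Γ → φ ≼ ⨂ Γ
∈⇒≼⨂ (here refl) = ≼-⊗ˡ ≼-refl
∈⇒≼⨂ (there φ∈Γ) = ≼-⊗ʳ (∈⇒≼⨂ φ∈Γ)

infix 4 _≟_
_≟_ : DecidableEquality Formula
atom p  ≟ atom q  = map′ (cong atom) (λ { refl → refl }) (p ℕ.≟ q)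
(φ ⊗ ψ) ≟ (χ ⊗ ω) = map′ (λ { (refl , refl) → refl }) (λ { refl → refl , refl }) (φ ≟ χ ×-dec ψ ≟ ω)
𝕀       ≟ 𝕀       = yes refl
(φ ⊸ ψ) ≟ (χ ⊸ ω) = map′ (λ { (refl , refl) → refl }) (λ { refl → refl , refl }) (φ ≟ χ ×-dec ψ ≟ ω)
atom _  ≟ (_ ⊗ _) = no λ ()
atom _  ≟ 𝕀       = no λ ()
atom _  ≟ (_ ⊸ _) = no λ ()
(_ ⊗ _) ≟ atom _  = no λ ()
(_ ⊗ _) ≟ 𝕀       = no λ ()
(_ ⊗ _) ≟ (_ ⊸ _) = no λ ()
𝕀       ≟ atom _  = no λ ()
𝕀       ≟ (_ ⊗ _) = no λ ()
𝕀       ≟ (_ ⊸ _) = no λ ()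
(_ ⊸ _) ≟ atom _  = no λ ()
(_ ⊸ _) ≟ (_ ⊗ _) = no λ ()
(_ ⊸ _) ≟ 𝕀       = no λ ()

index : Formula → List Formula → ℕ
index φ []      = 0
index φ (ψ ∷ Γ) with φ ≟ ψ
... | yes _ = 0
... | no  _ = suc (index φ Γ)

nth : List Formula → ℕ → Formula
nth []      _       = 𝕀
nth (φ ∷ Γ) zero    = φ
nth (φ ∷ Γ) (suc n) = nth Γ n

nth-index : ∀ {φ} Γ → φ ∈ Γ → nth Γ (index φ Γ) ≡ φ
nth-index {φ} (ψ ∷ Γ) φ∈ψ∷Γ with φ ≟ ψ | φ∈ψ∷Γ
... | yes φ≡ψ | _         = sym φ≡ψ
... | no  φ≢ψ | here φ≡ψ  = contradiction φ≡ψ φ≢ψ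
... | no  _   | there φ∈Γ = nth-index Γ φ∈Γ

-- N exceeds every atom of ρ, so the atoms N + k are fresh names for its non-atomic subformulas.
module SubformulaEncoding (ρ : Formula) where
  N : ℕ
  N = suc (atomSum ρ)

  encode : Formula → Atom
  encode (atom p)    = p
  encode φ@(_ ⊗ _)   = N + index φ (subformulas ρ)
  encode 𝕀           = N + index 𝕀 (subformulas ρ)
  encode φ@(_ ⊸ _)   = N + index φ (subformulas ρ)

  decode : Atom → Formula
  decode n with n <? N
  ... | yes _ = atom n
  ... | no  _ = nth (subformulas ρ) (n ∸ N)

  decode-< : ∀ n → n < N → decode n ≡ atom n
  decode-< n n<N with n <? N
  ... | yes _   = refl
  ... | no  n≮N = contradiction n<N n≮N

  decode-N+ : ∀ k → decode (N + k) ≡ nth (subformulas ρ) k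
  decode-N+ k with N + k <? N
  ... | yes N+k<N = contradiction N+k<N (m+n≮m N k)
  ... | no  _     = cong (nth (subformulas ρ)) (m+n∸m≡n N k)

  decode-encode : ∀ {φ} → φ ≼ ρ → decode (encode φ) ≡ φ
  decode-encode {atom p} φ≼ρ = decode-< p (s≤s (≼⇒atomSum≤ φ≼ρ))
  decode-encode {_ ⊗ _}  φ≼ρ = trans (decode-N+ _) (nth-index _ (≼⇒∈subformulas φ≼ρ))
  decode-encode {𝕀}      φ≼ρ = trans (decode-N+ _) (nth-index _ (≼⇒∈subformulas φ≼ρ))
  decode-encode {_ ⊸ _}  φ≼ρ = trans (decode-N+ _) (nth-index _ (≼⇒∈subformulas φ≼ρ))

  encoding : AtomicEncoding
  encoding = record
    { Sub           = _≼ ρ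
    ; Sub-⊗ˡ        = ≼-trans (≼-⊗ˡ ≼-refl)
    ; Sub-⊗ʳ        = ≼-trans (≼-⊗ʳ ≼-refl)
    ; Sub-⊸ˡ        = ≼-trans (≼-⊸ˡ ≼-refl)
    ; Sub-⊸ʳ        = ≼-trans (≼-⊸ʳ ≼-refl)
    ; encode        = encode
    ; decode        = decode
    ; encode-atom   = λ _ → refl
    ; decode-encode = decode-encode
    }

theorem4 : (Γ : List Formula) (φ : Formula) → Valid Γ φ → Γ ⊢ φ
theorem4 Γ φ =
  valid⇒⊢ Γ φ (All.tabulate (≼-⊸ˡ ∘ ∈⇒≼⨂)) (≼-⊸ʳ ≼-refl)
  where open Simulation (SubformulaEncoding.encoding (⨂ Γ ⊸ φ))
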